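{- Let $G$ be a full DAG with ample framing $F$, let $R$ be an exceptional route, and let $I(R)$ be the set of inner vertices of $G$ on $R$. Then either, at every $v\in I(R)$, both edges of $R$ incident to $v$ are the larger edges in the linear orders of $F$ on $\mathrm{in}(v)$ and $\mathrm{out}(v)$, or else, at every $v\in I(R)$, both edges of $R$ incident to $v$ are the smaller edges in these orders.
   Context: A DAG is a finite directed acyclic graph, possibly with multiple edges; sources have no incoming edges, sinks no outgoing edges, other vertices are inner; $\mathrm{in}(v),\mathrm{out}(v)$ are incoming/outgoing edges. $G$ is full if every inner vertex $v$ has $|\mathrm{in}(v)|=|\mathrm{out}(v)|=2$. A route is a maximal directed path (source to sink). A framing assigns to each inner vertex $v$ linear orders $\prec$ on $\mathrm{in}(v)$ and $\mathrm{out}(v)$. For inner $v$, paths in $\mathrm{Out}(v)$ (from $v$ to a sink) are compared by $P\prec Q$ iff at the last vertex $w$ of their common initial segment the edge of $P$ leaving $w$ precedes that of $Q$ in $\mathrm{out}(w)$; analogously for $\mathrm{In}(v)$ (paths from a source to $v$) at the first vertex of their common final segment using $\mathrm{in}(w)$. For a route $R$ through $v$, $Rv$, $vR$ are its parts before/after $v$. Routes $P,Q$ through a common inner vertex $v$ conflict at $v$ if, after possibly swapping them, $Pv\prec Qv$ and $vQ\prec vP$; coherent if no conflict at any common inner vertex. A route is exceptional if coherent with all routes. With $\mathcal{F}_+(G)\subset\mathbb{R}^{E(G)}$ the cone of nonnegative flows (conservation at inner vertices) and $v_R$ the indicator vector of $R$, a framing is ample if $\{v_R:R\text{ exceptional}\}$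 lies in no facet of $\mathcal{F}_+(G)$ (equivalently, every non-idle edge lies on an exceptional route; an edge is idle if it is the only incoming or only outgoing edge of an inner vertex). -}

module Defs where

open import Data.Nat using (ℕ)
open import Data.Fin using (Fin; _≟_)
open import Data.List using (List; []; _∷_; _++_; [_]; reverse; length; filter; allFin)
open import Data.List.Membership.Propositional using (_∈_)
open import Data.Product using (Σ; _×_; ∃; _,_)
open import Data.Sum using (_⊎_)
open import Data.Empty using (⊥)
open import Relation.Nullary using (¬_)
open import Relation.Binary.PropositionalEquality using (_≡_; _≢_)


record Graph : Set where
  field
    n m : ℕ
    src tgt : Fin m → Fin n

module _ (G : Graph) where
  open Graph G

  V : Set
  V = Fin n

  E : Set
  E = Fin m

  data IsWalk : V → List E → V → Set where
    nil  : ∀ {v} → IsWalk v [] v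
    cons : ∀ {u w e es} → src e ≡ u → IsWalk (tgt e) es w → IsWalk u (e ∷ es) w

  Acyclic : Set
  Acyclic = ∀ (e : E) (es : List E) → ¬ IsWalk (tgt e) es (src e)

  IsSource : V → Set
  IsSource v = ∀ (e : E) → tgt e ≢ v

  IsSink : V → Set
  IsSink v = ∀ (e : E) → src e ≢ v

  Inner : V → Set
  Inner v = ¬ IsSource v × ¬ IsSink v

  inDeg : V → ℕ
  inDeg v = length (filter (λ e → tgt e ≟ v) (allFin m))

  outDeg : V → ℕ
  outDeg v = length (filter (λ e → src e ≟ v) (allFin m))

  Full : Set
  Full = ∀ (v : V) → Inner v → inDeg v ≡ 2 × outDeg v ≡ 2

  -- A framing: at each inner vertex v, strict linear orders on in(v) and out(v).
  -- inLt v e f means e ≺ f in in(v); outLt v e f means e ≺ f in out(v).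
  record Framing : Set₁ where
    field
      inLt outLt : V → E → E → Set
      inLt-dom   : ∀ {v e f} → inLt v e f → Inner v × tgt e ≡ v × tgt f ≡ v
      outLt-dom  : ∀ {v e f} → outLt v e f → Inner v × src e ≡ v × src f ≡ v
      inLt-irr   : ∀ {v e} → ¬ inLt v e e
      outLt-irr  : ∀ {v e} → ¬ outLt v e e
      inLt-trans : ∀ {v e f g} → inLt v e f → inLt v f g → inLt v e g
      outLt-trans : ∀ {v e f g} → outLt v e f → outLt v f g → outLt v e g
      inLt-total : ∀ {v e f} → Inner v → tgt e ≡ v → tgt f ≡ v →
                   inLt v e f ⊎ e ≡ f ⊎ inLt v f e
      outLt-total : ∀ {v e f} → Inner v → src e ≡ v → src f ≡ v →
                    outLt v e f ⊎ e ≡ f ⊎ outLt v f e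

  data Lex (lt : V → E → E → Set) (key : E → V) : List E → List E → Set where
    here  : ∀ {e f es fs} → lt (key e) e f → Lex lt key (e ∷ es) (f ∷ fs)
    there : ∀ {e es fs} → Lex lt key es fs → Lex lt key (e ∷ es) (e ∷ fs)

  record Route : Set where
    field
      edges : List E
      start end : V
      walk : IsWalk start edges end
      start-source : IsSource start
      end-sink : IsSink end

  -- A passage of route R through vertex v: R = xs ++ a ∷ b ∷ ys with a entering v
  -- (hence b leaving v).  Then Rv = xs ++ [a] and vR = b ∷ ys.
  record Visit (R : Route) (v : V) : Set where
    field
      xs ys : List E
      a b : E
      split : Route.edges R ≡ xs ++ a ∷ b ∷ ys
      at : tgt a ≡ v

  before : ∀ {R v} → Visit R v → List E
  before vis = Visit.xs vis ++ [ Visit.a vis ]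

  after : ∀ {R v} → Visit R v → List E
  after vis = Visit.b vis ∷ Visit.ys vis

  module _ (F : Framing) where
    open Framing F

    -- order on In(v): compare at the first vertex of the common final segment
    _≺In_ : List E → List E → Set
    P ≺In Q = Lex inLt tgt (reverse P) (reverse Q)

    -- order on Out(v): compare at the last vertex of the common initial segment
    _≺Out_ : List E → List E → Set
    P ≺Out Q = Lex outLt src P Q

    ConflictAt : (P Q : Route) (v : V) → Visit P v → Visit Q v → Set
    ConflictAt P Q v vp vq =
      (before vp ≺In before vq × after vq ≺Out after vp)
      ⊎ (before vq ≺In before vp × after vp ≺Out after vq)

    Coherent : Route → Route → Set
    Coherent P Q = ∀ (v : V) → Inner v → (vp : Visit P v) (vq : Visit Q v) →
                   ¬ ConflictAt P Q v vp vq

    Exceptional : Route → Set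
    Exceptional R = ∀ (Q : Route) → Coherent R Q

    Idle : E → Set
    Idle e = (Inner (tgt e) × (∀ (f : E) → tgt f ≡ tgt e → f ≡ e))
           ⊎ (Inner (src e) × (∀ (f : E) → src f ≡ src e → f ≡ e))

    Ample : Set
    Ample = ∀ (e : E) → ¬ Idle e →
            Σ Route (λ R → Exceptional R × e ∈ Route.edges R)

    LargeAt : ∀ {R v} → Visit R v → Set
    LargeAt {v = v} vis =
      (∀ (f : E) → tgt f ≡ v → f ≢ Visit.a vis → inLt v f (Visit.a vis))
      × (∀ (f : E) → src f ≡ v → f ≢ Visit.b vis → outLt v f (Visit.b vis))

    SmallAt : ∀ {R v} → Visit R v → Set
    SmallAt {v = v} vis =
      (∀ (f : E) → tgt f ≡ v → f ≢ Visit.a vis → inLt v (Visit.a vis) f)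
      × (∀ (f : E) → src f ≡ v → f ≢ Visit.b vis → outLt v (Visit.b vis) f)

{-# OPTIONS --safe #-}
module Submission where

-- Let R enter a vertex u by a and leave a later (or the same) vertex w by b.
-- If f is the other in-edge at u and g the other out-edge at w, the detour T
-- that arrives at u through f, follows R from u to w and departs through g
-- exists as soon as f and g lie on some routes, which ampleness guarantees
-- because a full graph has no idle edges.  T and R share the segment from u
-- to w, so at u they conflict unless a and b are on the same side: a larger
-- in in(u) iff b larger in out(w).  Taking u to be the first inner vertex of
-- R fixes the side of every out-edge of R, and taking u = w then fixes the
-- side of every in-edge.

open import Defs
open import Data.Empty using (⊥-elim)
open import Data.Fin using (Fin; _≟_)
open import Data.List using (List; []; _∷_; _++_; [_]; length; filter; allFin)
open import Data.List.Membership.Propositional using (_∈_)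
open import Data.List.Membership.Propositional.Properties using (∈-∃++)
open import Data.List.Properties using (++-assoc; reverse-++)
open import Data.List.Relation.Unary.All using (All; []; _∷_)
open import Data.List.Relation.Unary.All.Properties using (all-filter)
open import Data.List.Relation.Unary.AllPairs using ([]; _∷_)
open import Data.List.Relation.Unary.Unique.Propositional using (Unique)
open import Data.List.Relation.Unary.Unique.Propositional.Properties using (allFin⁺; filter⁺)
open import Data.Nat using (_≤_; _<_; z≤n; s≤s; z<s; s<s)
open import Data.Nat.Properties using (m≤n⇒m≤1+n; <⇒≱)
open import Data.Product using (Σ; ∃; ∃₂; _×_; _,_; proj₁; proj₂; map₁; map₂)
open import Data.Sum as Sum using (_⊎_; inj₁; inj₂; swap; fromInj₁; fromInj₂)
open import Function using (_∘_; flip)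
open import Relation.Nullary using (¬_; yes; no)
open import Relation.Unary using (Decidable)
open import Relation.Binary.PropositionalEquality
  using (_≡_; _≢_; refl; sym; trans; subst; subst₂; cong)

another-of-two : ∀ {m} {P : Fin m → Set} {xs : List (Fin m)} →
                 Unique xs → length xs ≡ 2 → All P xs → ∀ x → ∃ λ y → P y × y ≢ x
another-of-two {xs = y ∷ z ∷ []} ((y≢z ∷ []) ∷ _) refl (py ∷ pz ∷ []) x with y ≟ x
... | yes refl = z , pz , y≢z ∘ sym
... | no y≢x   = y , py , y≢x

another-satisfying : ∀ {m} {P : Fin m → Set} (P? : Decidable P) →
                     length (filter P? (allFin m)) ≡ 2 → ∀ x → ∃ λ y → P y × y ≢ x
another-satisfying {m} P? two =
  another-of-two (filter⁺ P? (allFin⁺ m)) two (all-filter P? (allFin m))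

2≤length-++-∷-∷ : ∀ {A : Set} (xs : List A) {a b : A} {ys} → 2 ≤ length (xs ++ a ∷ b ∷ ys)
2≤length-++-∷-∷ []       = s≤s (s≤s z≤n)
2≤length-++-∷-∷ (_ ∷ xs) = m≤n⇒m≤1+n (2≤length-++-∷-∷ xs)

split-after-head : ∀ {A : Set} {x : A} {xs} ys {a zs} → x ∷ xs ≡ ys ++ a ∷ zs →
                 ∃ λ M → x ∷ xs ≡ x ∷ M ++ zs
split-after-head []       refl = [] , refl
split-after-head (y ∷ ys) {a} {zs} refl =
  ys ++ [ a ] , cong (y ∷_) (sym (++-assoc ys [ a ] zs))

module _ (G : Graph) where
  open Graph G

  other-in : Full G → ∀ {v} → Inner G v → ∀ e → ∃ λ f → tgt f ≡ v × f ≢ e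
  other-in full {v} inner = another-satisfying (λ f → tgt f ≟ v) (proj₁ (full v inner))

  other-out : Full G → ∀ {v} → Inner G v → ∀ e → ∃ λ f → src f ≡ v × f ≢ e
  other-out full {v} inner = another-satisfying (λ f → src f ≟ v) (proj₂ (full v inner))

  OnSomeRoute : E G → Set
  OnSomeRoute e = Σ (Route G) λ Q → e ∈ Route.edges Q

  full⇒¬Idle : Full G → (F : Framing G) → ∀ e → ¬ Idle G F e
  full⇒¬Idle full F e (inj₁ (inner , only-in)) =
    let f , tf , f≢e = other-in full inner e in f≢e (only-in f tf)
  full⇒¬Idle full F e (inj₂ (inner , only-out)) =
    let f , sf , f≢e = other-out full inner e in f≢e (only-out f sf)

  ample⇒on-route : Full G → (F : Framing G) → Ample G F → ∀ e → OnSomeRoute e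
  ample⇒on-route full F ample e = map₂ proj₂ (ample e (full⇒¬Idle full F e))

  walk-++ : ∀ {u x w xs ys} → IsWalk G u xs x → IsWalk G x ys w → IsWalk G u (xs ++ ys) w
  walk-++ nil         q = q
  walk-++ (cons eq p) q = cons eq (walk-++ p q)

  walk-split : ∀ {u w} xs e {ys} → IsWalk G u (xs ++ e ∷ ys) w →
               IsWalk G u xs (src e) × IsWalk G (tgt e) ys w
  walk-split []       e (cons refl q) = nil , q
  walk-split (x ∷ xs) e (cons eq q)   = map₁ (cons eq) (walk-split xs e q)

  route-walk : ∀ (R : Route G) {es} → Route.edges R ≡ es →
               IsWalk G (Route.start R) es (Route.end R)
  route-walk R refl = Route.walk R

  visit-src : ∀ {R v} (vis : Visit G R v) → src (Visit.b vis) ≡ v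
  visit-src {R} record { xs = xs ; a = a ; split = split ; at = refl }
    with _ , cons sb _ ← walk-split xs a (route-walk R split) = sb

  visit-inner : ∀ {R v} → Visit G R v → Inner G v
  visit-inner vis = (λ source → source (Visit.a vis) (Visit.at vis))
                  , (λ sink → sink (Visit.b vis) (visit-src vis))

  short-route-unvisited : ∀ {R : Route G} {v es} → Route.edges R ≡ es → length es < 2 →
                          ¬ Visit G R v
  short-route-unvisited refl short vis = <⇒≱ short
    (subst (λ es → 2 ≤ length es) (sym (Visit.split vis)) (2≤length-++-∷-∷ (Visit.xs vis)))

  visit-at : ∀ {R v} xs a M b ys → Route.edges R ≡ xs ++ a ∷ M ++ b ∷ ys → tgt a ≡ v →
             Σ (Visit G R v) λ vis → before G vis ≡ xs ++ [ a ] × after G vis ≡ M ++ b ∷ ys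
  visit-at xs a []      b ys R≡ at =
    record { xs = xs ; ys = ys ; a = a ; b = b ; split = R≡ ; at = at } , refl , refl
  visit-at xs a (m ∷ M) b ys R≡ at =
    record { xs = xs ; ys = M ++ b ∷ ys ; a = a ; b = m ; split = R≡ ; at = at } , refl , refl

  splice : ∀ (R : Route G) {xs a M b ys f g} → Route.edges R ≡ xs ++ a ∷ M ++ b ∷ ys →
           OnSomeRoute f → OnSomeRoute g → tgt f ≡ tgt a → src g ≡ src b →
           Σ (Route G) λ T → ∃₂ λ p s → Route.edges T ≡ p ++ f ∷ M ++ g ∷ s
  splice R {xs} {a} {M} {b} {ys} {f} {g} R≡ (Q₁ , f∈) (Q₂ , g∈) tf sg
    with p , _ , Q₁≡ ← ∈-∃++ f∈ | _ , s , Q₂≡ ← ∈-∃++ g∈ = T , p , s , refl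
    where
    to-f : IsWalk G (Route.start Q₁) p (src f)
    to-f = proj₁ (walk-split p f (route-walk Q₁ Q₁≡))
    along-M : IsWalk G (tgt f) M (src g)
    along-M = subst₂ (λ x y → IsWalk G x M y) (sym tf) (sym sg)
                (proj₁ (walk-split M b (proj₂ (walk-split xs a (route-walk R R≡)))))
    from-g : IsWalk G (tgt g) s (Route.end Q₂)
    from-g = proj₂ (walk-split _ g (route-walk Q₂ Q₂≡))
    T : Route G
    T = record { edges = p ++ f ∷ M ++ g ∷ s ; start = Route.start Q₁ ; end = Route.end Q₂
               ; walk = walk-++ to-f (cons refl (walk-++ along-M (cons refl from-g)))
               ; start-source = Route.start-source Q₁ ; end-sink = Route.end-sink Q₂ }

  Lex-++ˡ : ∀ {lt key} zs {xs ys} → Lex G lt key xs ys → Lex G lt key (zs ++ xs) (zs ++ ys)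
  Lex-++ˡ []       l = l
  Lex-++ˡ (_ ∷ zs) l = there (Lex-++ˡ zs l)

  module _ (F : Framing G) where
    open Framing F

    inLt-≢ : ∀ {v e f} → Inner G v → tgt e ≡ v → tgt f ≡ v → e ≢ f → inLt v e f ⊎ inLt v f e
    inLt-≢ inner te tf e≢f = Sum.map₂ (fromInj₂ (⊥-elim ∘ e≢f)) (inLt-total inner te tf)

    outLt-≢ : ∀ {v e f} → Inner G v → src e ≡ v → src f ≡ v → e ≢ f → outLt v e f ⊎ outLt v f e
    outLt-≢ inner se sf e≢f = Sum.map₂ (fromInj₂ (⊥-elim ∘ e≢f)) (outLt-total inner se sf)

    ≺In-by-last-edge : ∀ {a f} xs p → inLt (tgt a) a f → _≺In_ G F (xs ++ [ a ]) (p ++ [ f ])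
    ≺In-by-last-edge {a} {f} xs p a≺f =
      subst₂ (Lex G inLt tgt) (sym (reverse-++ xs [ a ])) (sym (reverse-++ p [ f ])) (here a≺f)

    Coherent-sym : ∀ {P Q : Route G} → Coherent G F P Q → Coherent G F Q P
    Coherent-sym coh v inner vq vp = coh v inner vp vq ∘ swap

    detour-incoherent : ∀ {P Q : Route G} {u w xs a M b ys p f g s} →
      Route.edges P ≡ xs ++ a ∷ M ++ b ∷ ys → Route.edges Q ≡ p ++ f ∷ M ++ g ∷ s →
      tgt a ≡ u → tgt f ≡ u → src g ≡ w → inLt u a f → outLt w g b → ¬ Coherent G F P Q
    detour-incoherent {xs = xs} {a} {M} {b} {ys} {p} {f} {g} {s} P≡ Q≡ refl tf refl a≺f g≺b coh
      with vp , before-p , after-p ← visit-at xs a M b ys P≡ refl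
         | vq , before-q , after-q ← visit-at p f M g s Q≡ tf
      = coh _ (visit-inner vp) vp vq (inj₁ (in-order , out-order))
      where
      in-order : _≺In_ G F (before G vp) (before G vq)
      in-order = subst₂ (_≺In_ G F) (sym before-p) (sym before-q) (≺In-by-last-edge xs p a≺f)
      out-order : _≺Out_ G F (after G vq) (after G vp)
      out-order = subst₂ (_≺Out_ G F) (sym after-q) (sym after-p) (Lex-++ˡ M (here g≺b))

module Uniform (G : Graph) (full : Full G) (F : Framing G)
               (on-route : ∀ e → OnSomeRoute G e)
               (R : Route G) (exc : Exceptional G F R) where
  open Graph G
  open Framing F

  larger-in⇒¬smaller-out : ∀ {u w xs a M b ys f g} → Route.edges R ≡ xs ++ a ∷ M ++ b ∷ ys →
    tgt a ≡ u → tgt f ≡ u → src b ≡ w → src g ≡ w → inLt u f a → ¬ outLt w b g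
  larger-in⇒¬smaller-out R≡ ta tf sb sg f≺a b≺g
    with T , _ , _ , T≡ ← splice G R R≡ (on-route _) (on-route _)
                                   (trans tf (sym ta)) (trans sg (sym sb))
    = detour-incoherent G F T≡ R≡ tf ta sb f≺a b≺g (Coherent-sym G F (exc T))

  smaller-in⇒¬larger-out : ∀ {u w xs a M b ys f g} → Route.edges R ≡ xs ++ a ∷ M ++ b ∷ ys →
    tgt a ≡ u → tgt f ≡ u → src b ≡ w → src g ≡ w → inLt u a f → ¬ outLt w g b
  smaller-in⇒¬larger-out R≡ ta tf sb sg a≺f g≺b
    with T , _ , _ , T≡ ← splice G R R≡ (on-route _) (on-route _)
                                   (trans tf (sym ta)) (trans sg (sym sb))
    = detour-incoherent G F R≡ T≡ ta tf sg a≺f g≺b (exc T)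

  module _ {a₀ b₀ ys₀} (R≡ : Route.edges R ≡ a₀ ∷ b₀ ∷ ys₀) where

    inner₀ : Inner G (tgt a₀)
    inner₀ = visit-inner G {R}
      record { xs = [] ; ys = ys₀ ; a = a₀ ; b = b₀ ; split = R≡ ; at = refl }

    from-first-edge : ∀ {v} (vis : Visit G R v) →
                      ∃ λ M → Route.edges R ≡ a₀ ∷ M ++ Visit.b vis ∷ Visit.ys vis
    from-first-edge vis =
      map₂ (trans R≡) (split-after-head (Visit.xs vis) (trans (sym R≡) (Visit.split vis)))

    all-large : ∀ {a′} → tgt a′ ≡ tgt a₀ → inLt (tgt a₀) a′ a₀ →
                ∀ {v} (vis : Visit G R v) → LargeAt G F vis
    all-large ta′ a′≺a₀ {v} vis = in-largest , out-largest
      where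
      open Visit vis
      inner = visit-inner G vis
      sb = visit-src G vis
      out-largest : ∀ g → src g ≡ v → g ≢ b → outLt v g b
      out-largest g sg g≢b = fromInj₁
        (⊥-elim ∘ larger-in⇒¬smaller-out {xs = []} (proj₂ (from-first-edge vis))
                                                  refl ta′ sb sg a′≺a₀)
        (outLt-≢ G F inner sg sb g≢b)
      in-largest : ∀ f → tgt f ≡ v → f ≢ a → inLt v f a
      in-largest f tf f≢a = let g , sg , g≢b = other-out G full inner b in fromInj₁
        (⊥-elim ∘ flip (smaller-in⇒¬larger-out {M = []} split at tf sb sg) (out-largest g sg g≢b))
        (inLt-≢ G F inner tf at f≢a)

    all-small : ∀ {a′} → tgt a′ ≡ tgt a₀ → inLt (tgt a₀) a₀ a′ →
                ∀ {v} (vis : Visit G R v) → SmallAt G F vis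
    all-small ta′ a₀≺a′ {v} vis = in-smallest , out-smallest
      where
      open Visit vis
      inner = visit-inner G vis
      sb = visit-src G vis
      out-smallest : ∀ g → src g ≡ v → g ≢ b → outLt v b g
      out-smallest g sg g≢b = fromInj₂
        (⊥-elim ∘ smaller-in⇒¬larger-out {xs = []} (proj₂ (from-first-edge vis))
                                                  refl ta′ sb sg a₀≺a′)
        (outLt-≢ G F inner sg sb g≢b)
      in-smallest : ∀ f → tgt f ≡ v → f ≢ a → inLt v a f
      in-smallest f tf f≢a = let g , sg , g≢b = other-out G full inner b in fromInj₂
        (⊥-elim ∘ flip (larger-in⇒¬smaller-out {M = []} split at tf sb sg) (out-smallest g sg g≢b))
        (inLt-≢ G F inner tf at f≢a)

    uniform : (∀ v → Inner G v → (vis : Visit G R v) → LargeAt G F vis)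
            ⊎ (∀ v → Inner G v → (vis : Visit G R v) → SmallAt G F vis)
    uniform with other-in G full inner₀ a₀
    ... | a′ , ta′ , a′≢a₀ with inLt-≢ G F inner₀ ta′ refl a′≢a₀
    ... | inj₁ a′≺a₀ = inj₁ λ _ _ → all-large ta′ a′≺a₀
    ... | inj₂ a₀≺a′ = inj₂ λ _ _ → all-small ta′ a₀≺a′

lemma3p3 : (G : Graph) → Acyclic G → Full G → (F : Framing G) → Ample G F →
    (R : Route G) → Exceptional G F R →
    (∀ (v : V G) → Inner G v → (vis : Visit G R v) → LargeAt G F vis)
    ⊎ (∀ (v : V G) → Inner G v → (vis : Visit G R v) → SmallAt G F vis)
lemma3p3 G _ full F ample R exc with Route.edges R in R≡
... | []        = inj₁ λ _ _ → ⊥-elim ∘ short-route-unvisited G R≡ z<s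
... | _ ∷ []    = inj₁ λ _ _ → ⊥-elim ∘ short-route-unvisited G R≡ (s<s z<s)
... | _ ∷ _ ∷ _ = Uniform.uniform G full F (ample⇒on-route G full F ample) R exc R≡
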